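{- Let $G$ be a finite connected simple undirected graph and $v_0\in V(G)$ such that: the graph $G\setminus\{v_0\}$ is connected; every simple cycle of $G$ has length at most $4$; every vertex of $G$ is at distance at most $2$ from $v_0$. Let $N_{v_0}$ be the set of vertices at distance $1$ from $v_0$, and assume $|N_{v_0}|\ge 3$. Suppose there exists $v_k\in N_{v_0}$ with $\deg_G(v_k)>2$, that $\deg_G(v)=2$ for every $v\in N_{v_0}\setminus\{v_k\}$, and that there exists $v_m\in N_{v_0}$ with $\{v_m,v_k\}\in E(G)$. Then the subgraph of $G$ induced by $N_{v_0}\cup\{v_0\}$ is the molecule $\theta^{1,|N_{v_0}|-1}_{v_0,v_k}$.
   Context: For distinct vertices $a,b$, $\varepsilon\in\{0,1\}$ and $n\ge 0$, the molecule $\theta^{\varepsilon,n}_{a,b}$ is the simple undirected graph with vertex set $\{a,b,u_1,\dots,u_n\}$ whose edges are $\{a,u_i\}$ and $\{u_i,b\}$ for $i=1,\dots,n$, together with the edge $\{a,b\}$ if $\varepsilon=1$ (and no other edges). Thus $\theta^{1,n}_{a,b}$ is the edge $\{a,b\}$ together with $n$ internally disjoint paths of length $2$ between $a$ and $b$. -}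

module Defs where

open import Data.Nat using (ℕ; zero; suc; _≤_; _<_; _∸_)
open import Data.Fin using (Fin)
open import Data.Bool using (Bool; true; false)
open import Data.List using (List; []; _∷_; length; filterᵇ; tail)
open import Data.List.Relation.Unary.All using (All)
open import Data.List.Relation.Unary.Unique.Propositional using (Unique)
open import Data.Maybe using (Maybe; just; nothing)
open import Data.Product using (Σ; ∃; _×_; _,_)
open import Data.Sum using (_⊎_)
open import Relation.Binary.PropositionalEquality using (_≡_; _≢_)
open import Relation.Nullary using (¬_)
open import Function.Definitions using (Injective)
open import Data.List using (allFin) public

record Graph (n : ℕ) : Set where
  field
    adj     : Fin n → Fin n → Bool
    adj-sym : ∀ x y → adj x y ≡ adj y x
    adj-irr : ∀ x → adj x x ≡ false
open Graph public

module _ {n : ℕ} (G : Graph n) where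

  data Walk : Fin n → Fin n → Set where
    []  : ∀ {x} → Walk x x
    _∷_ : ∀ {x y z} → adj G x y ≡ true → Walk y z → Walk x z

  wlength : ∀ {x y} → Walk x y → ℕ
  wlength []      = 0
  wlength (_ ∷ w) = suc (wlength w)

  support : ∀ {x y} → Walk x y → List (Fin n)
  support {x} []      = x ∷ []
  support {x} (_ ∷ w) = x ∷ support w

  Connected : Set
  Connected = ∀ x y → Walk x y

  ConnectedWithout : Fin n → Set
  ConnectedWithout v = ∀ x y → x ≢ v → y ≢ v →
    Σ (Walk x y) λ w → All (λ z → z ≢ v) (support w)

  -- a simple cycle: closed walk of length ≥ 3 whose vertices
  -- (the closing repetition of the start dropped) are pairwise distinct
  IsSimpleCycle : ∀ {x} → Walk x x → Set
  IsSimpleCycle w = 3 ≤ wlength w × Unique (tail' (support w))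
    where
    tail' : List (Fin n) → List (Fin n)
    tail' []       = []
    tail' (_ ∷ xs) = xs

  DistAtMost : ℕ → Fin n → Fin n → Set
  DistAtMost k u v = Σ (Walk u v) λ w → wlength w ≤ k

  nbrs : Fin n → List (Fin n)
  nbrs v = filterᵇ (adj G v) (allFin n)

  deg : Fin n → ℕ
  deg v = length (nbrs v)

-- Vertices of the molecule θ^{ε,m}_{a,b}: a, b, u_1 … u_m
data MV (m : ℕ) : Set where
  va : MV m
  vb : MV m
  vu : Fin m → MV m

molAdj : ∀ {m} → Bool → MV m → MV m → Bool
molAdj ε va vb = ε
molAdj ε vb va = ε
molAdj ε va (vu _) = true
molAdj ε (vu _) va = true
molAdj ε vb (vu _) = true
molAdj ε (vu _) vb = true
molAdj ε _ _ = false

-- The subgraph of G induced by the vertex set S is the molecule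
-- θ^{ε,m}_{a,b} (with its endpoints being the given vertices a and b of G):
-- there is a bijection φ from the molecule's vertices onto S with
-- φ va = a, φ vb = b, preserving and reflecting adjacency.
IsInducedMolecule : ∀ {n} (G : Graph n) (S : Fin n → Set)
  (ε : Bool) (m : ℕ) (a b : Fin n) → Set
IsInducedMolecule {n} G S ε m a b =
  Σ (MV m → Fin n) λ φ →
    Injective _≡_ _≡_ φ
    × (∀ p → S (φ p))
    × (∀ x → S x → ∃ λ p → φ p ≡ x)
    × φ va ≡ a
    × φ vb ≡ b
    × (∀ p q → adj G (φ p) (φ q) ≡ molAdj ε p q)

-- vₘ has degree 2, so its neighbours are exactly v₀ and vₖ. Let u ≠ vₖ be
-- another neighbour of v₀ and take a shortest path P from u to vₖ in G ∖ {v₀}.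
-- Closing P through v₀ gives a simple cycle of length |P| + 2, so |P| ≤ 2;
-- and |P| = 2, say u y vₖ, is excluded because then v₀ vₘ vₖ y u is a simple
-- 5-cycle (y ≠ vₘ as vₘ is not adjacent to u). Hence every neighbour of v₀
-- other than vₖ is adjacent to vₖ; having degree 2, it has no further
-- neighbours, in particular none in N_{v₀}.
module Submission where

open import Defs
open import Data.Nat using (ℕ; suc; _+_; _≤_; _<_; _≰_; _∸_; z≤n; s≤s)
open import Data.Fin using (Fin; zero; suc; punchIn; punchOut) renaming (_≟_ to _≟ᶠ_)
open import Data.Fin.Properties using (punchIn-injective; punchInᵢ≢i; punchIn-punchOut)
open import Data.Bool using (true; false)
open import Data.Bool.Properties using (T?; T-≡)
open import Data.Product using (Σ; ∃; _×_; _,_; proj₂)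
open import Data.Sum using (_⊎_; inj₁; inj₂; swap)
open import Data.Empty using (⊥; ⊥-elim)
open import Data.List using (List; []; _∷_; _++_; length; lookup)
import Data.List.Relation.Unary.All as All
open All using (All; []; _∷_)
open import Data.List.Relation.Unary.All.Properties using (¬Any⇒All¬) renaming (++⁺ to All-++⁺)
open import Data.List.Relation.Unary.Any using (here; there; index)
open import Data.List.Relation.Unary.Any.Properties using (lookup-index)
open import Data.List.Relation.Unary.Unique.Propositional using (Unique)
open import Data.List.Relation.Unary.Unique.Propositional.Properties using (allFin⁺; filter⁺)
open import Data.List.Relation.Unary.AllPairs using ([]; _∷_)
open import Data.List.Membership.Propositional using (_∈_)
open import Data.List.Membership.Propositional.Properties using (∈-filter⁺; ∈-filter⁻; ∈-allFin; ∈-lookup)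
open import Function using (_∘_; Equivalence)
open import Function.Definitions using (Injective)
open import Relation.Nullary using (yes; no)
open import Relation.Binary.PropositionalEquality using (_≡_; _≢_; refl; sym; trans; cong; subst)

private
  variable
    A : Set

lookup-injective : ∀ {xs : List A} → Unique xs → ∀ {i j} → lookup xs i ≡ lookup xs j → i ≡ j
lookup-injective {xs = x ∷ xs} (x∉ ∷ u) {zero}  {zero}  _  = refl
lookup-injective {xs = x ∷ xs} (x∉ ∷ u) {zero}  {suc j} eq = ⊥-elim (All.lookup x∉ (∈-lookup j) eq)
lookup-injective {xs = x ∷ xs} (x∉ ∷ u) {suc i} {zero}  eq = ⊥-elim (All.lookup x∉ (∈-lookup i) (sym eq))
lookup-injective {xs = x ∷ xs} (x∉ ∷ u) {suc i} {suc j} eq = cong suc (lookup-injective u eq)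

∈-pair : ∀ {a x y : A} → a ∈ x ∷ y ∷ [] → a ≡ x ⊎ a ≡ y
∈-pair (here a≡x)         = inj₁ a≡x
∈-pair (there (here a≡y)) = inj₂ a≡y

length≡2⇒≡⊎≡ : ∀ {xs : List A} {a b c} → length xs ≡ 2 → a ≢ b →
               a ∈ xs → b ∈ xs → c ∈ xs → c ≡ a ⊎ c ≡ b
length≡2⇒≡⊎≡ {xs = []}              ()
length≡2⇒≡⊎≡ {xs = _ ∷ []}          ()
length≡2⇒≡⊎≡ {xs = _ ∷ _ ∷ _ ∷ _}   ()
length≡2⇒≡⊎≡ {xs = x ∷ y ∷ []} refl a≢b a∈ b∈ c∈ with ∈-pair a∈ | ∈-pair b∈
... | inj₁ refl | inj₁ refl = ⊥-elim (a≢b refl)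
... | inj₂ refl | inj₂ refl = ⊥-elim (a≢b refl)
... | inj₁ refl | inj₂ refl = ∈-pair c∈
... | inj₂ refl | inj₁ refl = swap (∈-pair c∈)

lookupExcept : (xs : List A) → Fin (length xs) → Fin (length xs ∸ 1) → A
lookupExcept (x ∷ xs) i j = lookup (x ∷ xs) (punchIn i j)

lookupExcept-∈ : ∀ {xs : List A} {i} j → lookupExcept xs i j ∈ xs
lookupExcept-∈ {xs = _ ∷ _} {i} j = ∈-lookup (punchIn i j)

lookupExcept-≢ : ∀ {xs : List A} {i} → Unique xs → ∀ j → lookupExcept xs i j ≢ lookup xs i
lookupExcept-≢ {xs = _ ∷ _} {i} u j = punchInᵢ≢i i j ∘ lookup-injective u

lookupExcept-injective : ∀ {xs : List A} {i} → Unique xs → Injective _≡_ _≡_ (lookupExcept xs i)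
lookupExcept-injective {xs = _ ∷ _} {i} u = punchIn-injective i _ _ ∘ lookup-injective u

lookupExcept-surjective : ∀ {xs : List A} {i z} → z ∈ xs → z ≢ lookup xs i →
                          ∃ λ j → lookupExcept xs i j ≡ z
lookupExcept-surjective {xs = _ ∷ _} {i} z∈ z≢ =
  punchOut i≢k , trans (cong (lookup _) (punchIn-punchOut i≢k)) (sym (lookup-index z∈))
  where
  i≢k : i ≢ index z∈
  i≢k i≡k = z≢ (trans (lookup-index z∈) (cong (lookup _) (sym i≡k)))

module _ {n : ℕ} (G : Graph n) where
  open import Data.List.Membership.DecPropositional (_≟ᶠ_ {n}) using (_∈?_)

  adj⇒≢ : ∀ {x y} → adj G x y ≡ true → x ≢ y
  adj⇒≢ {x} e refl with trans (sym e) (adj-irr G x)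
  ... | ()

  adj-flip : ∀ {x y} → adj G x y ≡ true → adj G y x ≡ true
  adj-flip {x} {y} = trans (adj-sym G y x)

  ∈-nbrs⁺ : ∀ {v x} → adj G v x ≡ true → x ∈ nbrs G v
  ∈-nbrs⁺ {v} e = ∈-filter⁺ (T? ∘ adj G v) (∈-allFin _) (Equivalence.from T-≡ e)

  ∈-nbrs⁻ : ∀ {v x} → x ∈ nbrs G v → adj G v x ≡ true
  ∈-nbrs⁻ {v} x∈ = Equivalence.to T-≡ (proj₂ (∈-filter⁻ (T? ∘ adj G v) {xs = allFin n} x∈))

  nbrs-unique : ∀ v → Unique (nbrs G v)
  nbrs-unique v = filter⁺ (T? ∘ adj G v) (allFin⁺ n)

  deg≡2⇒adj⇒≡⊎≡ : ∀ {v a b c} → deg G v ≡ 2 → a ≢ b →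
                  adj G v a ≡ true → adj G v b ≡ true → adj G v c ≡ true → c ≡ a ⊎ c ≡ b
  deg≡2⇒adj⇒≡⊎≡ d≡2 a≢b ea eb ec = length≡2⇒≡⊎≡ d≡2 a≢b (∈-nbrs⁺ ea) (∈-nbrs⁺ eb) (∈-nbrs⁺ ec)

  IsPath : ∀ {x y} → Walk G x y → Set
  IsPath w = Unique (support G w)

  _⊆ˢ_ : ∀ {x y x′ y′} → Walk G x y → Walk G x′ y′ → Set
  p ⊆ˢ w = ∀ {z} → z ∈ support G p → z ∈ support G w

  suffixFrom : ∀ {x y z} (p : Walk G y z) → x ∈ support G p → IsPath p →
               Σ (Walk G x z) λ q → IsPath q × q ⊆ˢ p
  suffixFrom []      (here refl) u       = [] , u , λ z∈ → z∈
  suffixFrom (e ∷ p) (here refl) u       = e ∷ p , u , λ z∈ → z∈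
  suffixFrom (e ∷ p) (there x∈)  (_ ∷ u) with suffixFrom p x∈ u
  ... | q , uq , q⊆p = q , uq , there ∘ q⊆p

  walk⇒path : ∀ {x y} (w : Walk G x y) → Σ (Walk G x y) λ p → IsPath p × p ⊆ˢ w
  walk⇒path [] = [] , [] ∷ [] , λ z∈ → z∈
  walk⇒path {x} (e ∷ w) with walk⇒path w
  ... | p , up , p⊆w with x ∈? support G p
  ...   | yes x∈ with suffixFrom p x∈ up
  ...     | q , uq , q⊆p = q , uq , there ∘ p⊆w ∘ q⊆p
  walk⇒path {x} (e ∷ w) | p , up , p⊆w | no x∉ =
    e ∷ p , ¬Any⇒All¬ _ x∉ ∷ up , λ { (here z≡x) → here z≡x ; (there z∈) → there (p⊆w z∈) }

  avoiding-⊆ˢ : ∀ {v x y x′ y′} {p : Walk G x y} {w : Walk G x′ y′} → p ⊆ˢ w →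
                All (_≢ v) (support G w) → All (_≢ v) (support G p)
  avoiding-⊆ˢ p⊆w avoid = All.tabulate (All.lookup avoid ∘ p⊆w)

  snoc : ∀ {x y z} → Walk G x y → adj G y z ≡ true → Walk G x z
  snoc []       e = e ∷ []
  snoc (e′ ∷ w) e = e′ ∷ snoc w e

  support-snoc : ∀ {x y z} (w : Walk G x y) (e : adj G y z ≡ true) →
                 support G (snoc w e) ≡ support G w ++ z ∷ []
  support-snoc []       e = refl
  support-snoc (e′ ∷ w) e = cong (_ ∷_) (support-snoc w e)

  wlength-snoc : ∀ {x y z} (w : Walk G x y) (e : adj G y z ≡ true) →
                 wlength G (snoc w e) ≡ suc (wlength G w)
  wlength-snoc []       e = refl
  wlength-snoc (e′ ∷ w) e = cong suc (wlength-snoc w e)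

  unique-∷ʳ : ∀ {v} {xs : List (Fin n)} → Unique xs → All (_≢ v) xs → Unique (xs ++ v ∷ [])
  unique-∷ʳ []         []            = [] ∷ []
  unique-∷ʳ (x∉ ∷ u)   (x≢v ∷ avoid) = All-++⁺ x∉ (x≢v ∷ []) ∷ unique-∷ʳ u avoid

  MaxCycleLength : ℕ → Set
  MaxCycleLength k = ∀ {x} (w : Walk G x x) → IsSimpleCycle G w → wlength G w ≤ k

  -- A path between two neighbours of v that avoids v closes to a simple cycle through v.
  path-through-nbrs-short : ∀ {k v x y} → MaxCycleLength k →
    adj G v x ≡ true → adj G y v ≡ true →
    (p : Walk G x y) → IsPath p → All (_≢ v) (support G p) →
    1 ≤ wlength G p → 2 + wlength G p ≤ k
  path-through-nbrs-short {k} max evx eyv p up avoid 1≤p =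
    subst (_≤ k) |C|≡ (max C (subst (3 ≤_) (sym |C|≡) (s≤s (s≤s 1≤p)) , simple))
    where
    C = evx ∷ snoc p eyv
    |C|≡ : wlength G C ≡ 2 + wlength G p
    |C|≡ = cong suc (wlength-snoc p eyv)
    simple : Unique (support G (snoc p eyv))
    simple = subst Unique (sym (support-snoc p eyv)) (unique-∷ʳ up avoid)

module _ {n : ℕ} (G : Graph n) (v₀ : Fin n)
  (connected-without-v₀ : ConnectedWithout G v₀)
  (max-cycle : MaxCycleLength G 4)
  (vₖ : Fin n) (e₀ₖ : adj G v₀ vₖ ≡ true)
  (deg≡2 : ∀ v → adj G v₀ v ≡ true → v ≢ vₖ → deg G v ≡ 2)
  (vₘ : Fin n) (e₀ₘ : adj G v₀ vₘ ≡ true) (eₘₖ : adj G vₘ vₖ ≡ true) where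

  nbr-deg2⇒≡⊎≡ : ∀ {u c} → adj G v₀ u ≡ true → u ≢ vₖ → adj G u vₖ ≡ true →
                 adj G u c ≡ true → c ≡ v₀ ⊎ c ≡ vₖ
  nbr-deg2⇒≡⊎≡ e₀ᵤ u≢k eᵤₖ =
    deg≡2⇒adj⇒≡⊎≡ G (deg≡2 _ e₀ᵤ u≢k) (adj⇒≢ G e₀ₖ) (adj-flip G e₀ᵤ) eᵤₖ

  5+k≰4 : ∀ {k} → 5 + k ≰ 4
  5+k≰4 (s≤s (s≤s (s≤s (s≤s ()))))

  no-path-of-length-2-to-vₖ : ∀ {u y} → adj G v₀ u ≡ true → u ≢ vₖ → u ≢ vₘ →
    adj G u y ≡ true → adj G y vₖ ≡ true → y ≢ v₀ → ⊥
  no-path-of-length-2-to-vₖ {u} {y} e₀ᵤ u≢k u≢m euy eyₖ y≢0 =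
    5+k≰4 (path-through-nbrs-short G max-cycle e₀ₘ (adj-flip G e₀ᵤ) p unique avoid (s≤s z≤n))
    where
    p = eₘₖ ∷ adj-flip G eyₖ ∷ adj-flip G euy ∷ []
    y≢m : y ≢ vₘ
    y≢m refl with nbr-deg2⇒≡⊎≡ e₀ₘ (adj⇒≢ G eₘₖ) eₘₖ (adj-flip G euy)
    ... | inj₁ u≡0 = adj⇒≢ G e₀ᵤ (sym u≡0)
    ... | inj₂ u≡k = u≢k u≡k
    unique : Unique (vₘ ∷ vₖ ∷ y ∷ u ∷ [])
    unique = (adj⇒≢ G eₘₖ ∷ y≢m ∘ sym ∷ u≢m ∘ sym ∷ [])
           ∷ (adj⇒≢ G eyₖ ∘ sym ∷ u≢k ∘ sym ∷ [])
           ∷ (adj⇒≢ G euy ∘ sym ∷ [])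
           ∷ [] ∷ []
    avoid : All (_≢ v₀) (vₘ ∷ vₖ ∷ y ∷ u ∷ [])
    avoid = adj⇒≢ G e₀ₘ ∘ sym ∷ adj⇒≢ G e₀ₖ ∘ sym ∷ y≢0 ∷ adj⇒≢ G e₀ᵤ ∘ sym ∷ []

  nbr⇒adj-vₖ : ∀ {u} → adj G v₀ u ≡ true → u ≢ vₖ → adj G u vₖ ≡ true
  nbr⇒adj-vₖ {u} e₀ᵤ u≢k with u ≟ᶠ vₘ
  ... | yes refl = eₘₖ
  ... | no u≢m with connected-without-v₀ u vₖ (adj⇒≢ G e₀ᵤ ∘ sym) (adj⇒≢ G e₀ₖ ∘ sym)
  ...   | w , w-avoids with walk⇒path G w
  ...     | p , up , p⊆w = shortest p up (avoiding-⊆ˢ G p⊆w w-avoids)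
    where
    shortest : (p : Walk G u vₖ) → IsPath G p → All (_≢ v₀) (support G p) → adj G u vₖ ≡ true
    shortest []                  _  _                 = ⊥-elim (u≢k refl)
    shortest (e ∷ [])            _  _                 = e
    shortest (e ∷ e′ ∷ [])       _  (_ ∷ y≢0 ∷ _)     = ⊥-elim (no-path-of-length-2-to-vₖ e₀ᵤ u≢k u≢m e e′ y≢0)
    shortest p@(_ ∷ _ ∷ _ ∷ _)   up avoid =
      ⊥-elim (5+k≰4 (path-through-nbrs-short G max-cycle e₀ᵤ (adj-flip G e₀ₖ) p up avoid (s≤s z≤n)))

  nbrs-nonadjacent : ∀ {a b} → adj G v₀ a ≡ true → a ≢ vₖ → adj G v₀ b ≡ true → b ≢ vₖ →
                     adj G a b ≡ false
  nbrs-nonadjacent {a} {b} e₀ₐ a≢k e₀b b≢k with adj G a b in eab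
  ... | false = refl
  ... | true with nbr-deg2⇒≡⊎≡ e₀ₐ a≢k (nbr⇒adj-vₖ e₀ₐ a≢k) eab
  ...   | inj₁ b≡0 = ⊥-elim (adj⇒≢ G e₀b (sym b≡0))
  ...   | inj₂ b≡k = ⊥-elim (b≢k b≡k)

  vₖ∈N : vₖ ∈ nbrs G v₀
  vₖ∈N = ∈-nbrs⁺ G e₀ₖ

  lookup-vₖ : lookup (nbrs G v₀) (index vₖ∈N) ≡ vₖ
  lookup-vₖ = sym (lookup-index vₖ∈N)

  u : Fin (deg G v₀ ∸ 1) → Fin n
  u = lookupExcept (nbrs G v₀) (index vₖ∈N)

  u-nbr : ∀ j → adj G v₀ (u j) ≡ true
  u-nbr j = ∈-nbrs⁻ G (lookupExcept-∈ j)

  u≢vₖ : ∀ j → u j ≢ vₖ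
  u≢vₖ j uj≡k = lookupExcept-≢ (nbrs-unique G v₀) j (trans uj≡k (sym lookup-vₖ))

  u≢v₀ : ∀ j → u j ≢ v₀
  u≢v₀ j = adj⇒≢ G (u-nbr j) ∘ sym

  embed : MV (deg G v₀ ∸ 1) → Fin n
  embed va     = v₀
  embed vb     = vₖ
  embed (vu j) = u j

  embed-injective : Injective _≡_ _≡_ embed
  embed-injective {va}   {va}   _  = refl
  embed-injective {va}   {vb}   eq = ⊥-elim (adj⇒≢ G e₀ₖ eq)
  embed-injective {va}   {vu j} eq = ⊥-elim (u≢v₀ j (sym eq))
  embed-injective {vb}   {va}   eq = ⊥-elim (adj⇒≢ G e₀ₖ (sym eq))
  embed-injective {vb}   {vb}   _  = refl
  embed-injective {vb}   {vu j} eq = ⊥-elim (u≢vₖ j (sym eq))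
  embed-injective {vu i} {va}   eq = ⊥-elim (u≢v₀ i eq)
  embed-injective {vu i} {vb}   eq = ⊥-elim (u≢vₖ i eq)
  embed-injective {vu i} {vu j} eq = cong vu (lookupExcept-injective (nbrs-unique G v₀) eq)

  Closed-nbhd : Fin n → Set
  Closed-nbhd x = adj G v₀ x ≡ true ⊎ x ≡ v₀

  embed-into : ∀ p → Closed-nbhd (embed p)
  embed-into va     = inj₂ refl
  embed-into vb     = inj₁ e₀ₖ
  embed-into (vu j) = inj₁ (u-nbr j)

  embed-onto : ∀ x → Closed-nbhd x → ∃ λ p → embed p ≡ x
  embed-onto x (inj₂ refl) = va , refl
  embed-onto x (inj₁ e₀ₓ) with x ≟ᶠ vₖ
  ... | yes refl = vb , refl
  ... | no x≢k with lookupExcept-surjective (∈-nbrs⁺ G e₀ₓ) (x≢k ∘ λ x≡ → trans x≡ lookup-vₖ)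
  ...   | j , uj≡x = vu j , uj≡x

  embed-adj : ∀ p q → adj G (embed p) (embed q) ≡ molAdj true p q
  embed-adj va     va     = adj-irr G v₀
  embed-adj va     vb     = e₀ₖ
  embed-adj va     (vu j) = u-nbr j
  embed-adj vb     va     = adj-flip G e₀ₖ
  embed-adj vb     vb     = adj-irr G vₖ
  embed-adj vb     (vu j) = adj-flip G (nbr⇒adj-vₖ (u-nbr j) (u≢vₖ j))
  embed-adj (vu i) va     = adj-flip G (u-nbr i)
  embed-adj (vu i) vb     = nbr⇒adj-vₖ (u-nbr i) (u≢vₖ i)
  embed-adj (vu i) (vu j) = nbrs-nonadjacent (u-nbr i) (u≢vₖ i) (u-nbr j) (u≢vₖ j)

  closed-nbhd-is-molecule : IsInducedMolecule G Closed-nbhd true (deg G v₀ ∸ 1) v₀ vₖ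
  closed-nbhd-is-molecule = embed , embed-injective , embed-into , embed-onto , refl , refl , embed-adj

mainTheorem4 : {n : ℕ} (G : Graph n) (v₀ : Fin n) →
    Connected G →
    ConnectedWithout G v₀ →
    (∀ {x} (w : Walk G x x) → IsSimpleCycle G w → wlength G w ≤ 4) →
    (∀ v → DistAtMost G 2 v₀ v) →
    3 ≤ deg G v₀ →
    (vₖ : Fin n) → adj G v₀ vₖ ≡ true → 2 < deg G vₖ →
    (∀ v → adj G v₀ v ≡ true → v ≢ vₖ → deg G v ≡ 2) →
    (Σ (Fin n) λ vₘ → adj G v₀ vₘ ≡ true × adj G vₘ vₖ ≡ true) →
    IsInducedMolecule G (λ x → adj G v₀ x ≡ true ⊎ x ≡ v₀)
      true (deg G v₀ ∸ 1) v₀ vₖ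
mainTheorem4 G v₀ _ connected-without-v₀ max-cycle _ _ vₖ e₀ₖ _ deg≡2 (vₘ , e₀ₘ , eₘₖ) =
  closed-nbhd-is-molecule G v₀ connected-without-v₀ max-cycle vₖ e₀ₖ deg≡2 vₘ e₀ₘ eₘₖ
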